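{- Let $(X,\le)$ be a poset and $E$ an equivalence relation on $X$ with ${\le}\subseteq E$. If $\alpha\colon X\to X$ is an order automorphism of $(X,\le)$ with $\alpha\subseteq E$, then $\alpha\circ(\le^{c})^{\smile}=(\le^{c})^{\smile}\circ\alpha\in\mathsf{Up}(\mathbf E)$.
   Context: Relations: $R\circ S=\{(x,y)\mid\exists z\,((x,z)\in R,(z,y)\in S)\}$, $R^{\smile}$ the converse; functions are identified with their graphs $\{(x,\gamma(x))\}$. Order automorphism: bijection with $x\le y\iff\alpha(x)\le\alpha(y)$. $E$ is ordered by $(u,v)\preceq(x,y)$ iff $x\le u$ and $v\le y$; $\mathsf{Up}(\mathbf E)$ is the set of up-sets of $\mathbf E=(E,\preceq)$; for $R\subseteq E$, $R^{c}=E\setminus R$ (so $\le^{c}=E\setminus{\le}$). -}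

module Defs where

open import Level using (Level; _⊔_)
open import Data.Product using (Σ; ∃; _×_)
open import Relation.Nullary using (¬_)
open import Relation.Binary.Core using (Rel; _⇒_)
open import Relation.Binary.PropositionalEquality using (_≡_)

private variable
  a ℓ₁ ℓ₂ ℓ₃ : Level
  X : Set a

_⨾_ : Rel X ℓ₁ → Rel X ℓ₂ → Rel X _
(R ⨾ S) x y = ∃ λ z → R x z × S z y

_˘ : Rel X ℓ₁ → Rel X ℓ₁
(R ˘) x y = R y x

graph : (X → X) → Rel X _
graph γ x y = γ x ≡ y

compl : Rel X ℓ₁ → Rel X ℓ₂ → Rel X (ℓ₁ ⊔ ℓ₂)
compl E R x y = E x y × ¬ R x y


-- R ∈ Up(E,⪯):  R ⊆ E and R is upward closed in (E, ⪯)
Up : Rel X ℓ₁ → Rel X ℓ₂ → Rel X ℓ₃ → Set _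
Up {X = X} _≤_ E R =
  (R ⇒ E) ×
  (∀ {u v x y : X} → R u v → E x y → x ≤ u → v ≤ y → R x y)
-- (here (u,v) ⪯ (x,y) is spelled out as  x ≤ u  and  v ≤ y)

-- An order automorphism α that stays inside E preserves and reflects both E and ≤,
-- hence also the relation ≤ᶜ˘ = (E ∖ ≤)˘; since α is onto, composing with the graph
-- of α on either side then gives the same relation.  Concretely, (x, y) lies in
-- α ⨾ ≤ᶜ˘ iff E y (α x) and y ≰ α x, and upward closure follows from
-- v ≤ y ≤ α x ≤ α u whenever x ≤ u and v ≤ y.
module Submission where

open import Defs
open import Level using (Level)
open import Relation.Binary.Core using (Rel; _⇒_) renaming (_⇔_ to _⇔ʳ_)
open import Relation.Binary.Definitions using (Transitive)
open import Relation.Binary.Structures using (IsPartialOrder; IsEquivalence)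
open import Relation.Binary.PropositionalEquality using (_≡_; refl)
open import Function.Definitions using (Bijective; StrictlySurjective)
open import Function.Consequences using (surjective⇒strictlySurjective)
open import Function.Bundles using (_⇔_; mk⇔; Equivalence)
open import Data.Product using (_×_; _,_; map)
open import Relation.Nullary using (contraposition)

private variable
  a ℓ ℓ′ : Level
  X : Set a

Invariant : (X → X) → Rel X ℓ → Set _
Invariant f R = ∀ x y → R x y ⇔ R (f x) (f y)

invariant-˘ : {f : X → X} {R : Rel X ℓ} → Invariant f R → Invariant f (R ˘)
invariant-˘ inv x y = inv y x

invariant-compl : {f : X → X} {E : Rel X ℓ} {R : Rel X ℓ′} →
                  Invariant f E → Invariant f R → Invariant f (compl E R)
invariant-compl invE invR x y = mk⇔
  (map (Equivalence.to (invE x y)) (contraposition (Equivalence.from (invR x y))))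
  (map (Equivalence.from (invE x y)) (contraposition (Equivalence.to (invR x y))))

invariant-equivalence : {f : X → X} {E : Rel X ℓ} →
                        IsEquivalence E → graph f ⇒ E → Invariant f E
invariant-equivalence isEq f⊆E x y = mk⇔
  (λ Exy → trans (sym (f⊆E refl)) (trans Exy (f⊆E refl)))
  (λ Efxfy → trans (f⊆E refl) (trans Efxfy (sym (f⊆E refl))))
  where open IsEquivalence isEq using (sym; trans)

graph⨾-comm : {f : X → X} {R : Rel X ℓ} → StrictlySurjective _≡_ f →
              Invariant f R → (graph f ⨾ R) ⇔ʳ (R ⨾ graph f)
graph⨾-comm {f = f} {R} onto inv = forward , backward
  where
  forward : graph f ⨾ R ⇒ R ⨾ graph f
  forward {x} {y} (_ , refl , Rfxy) with onto y
  ... | z , refl = z , Equivalence.from (inv x z) Rfxy , refl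

  backward : R ⨾ graph f ⇒ graph f ⨾ R
  backward {x} (z , Rxz , refl) = f x , refl , Equivalence.to (inv x z) Rxz

Up-graph⨾compl˘ : {_≤_ : Rel X ℓ} {E : Rel X ℓ′} {f : X → X} →
                  Transitive _≤_ → IsEquivalence E →
                  (∀ {x y} → x ≤ y → f x ≤ f y) → graph f ⇒ E →
                  Up _≤_ E (graph f ⨾ (compl E _≤_ ˘))
Up-graph⨾compl˘ {_≤_ = _≤_} {E} {f} ≤-trans isEq f-mono f⊆E = ⊆E , upward-closed
  where
  open IsEquivalence isEq using (sym; trans)

  ⊆E : graph f ⨾ (compl E _≤_ ˘) ⇒ E
  ⊆E (_ , refl , Eyfx , _) = sym (trans Eyfx (sym (f⊆E refl)))

  upward-closed : ∀ {u v x y} → (graph f ⨾ (compl E _≤_ ˘)) u v → E x y →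
                  x ≤ u → v ≤ y → (graph f ⨾ (compl E _≤_ ˘)) x y
  upward-closed (_ , refl , _ , v≰fu) Exy x≤u v≤y =
    _ , refl , trans (sym Exy) (f⊆E refl) ,
    λ y≤fx → v≰fu (≤-trans (≤-trans v≤y y≤fx) (f-mono x≤u))

lemma3p9 : {a ℓ₁ ℓ₂ : Level} {X : Set a} (_≤_ : Rel X ℓ₁) (E : Rel X ℓ₂)
    → IsPartialOrder _≡_ _≤_
    → IsEquivalence E
    → _≤_ ⇒ E
    → (α : X → X)
    → Bijective _≡_ _≡_ α
    → (∀ x y → (x ≤ y) ⇔ (α x ≤ α y))
    → graph α ⇒ E
    → ((graph α ⨾ (compl E _≤_ ˘)) ⇔ʳ ((compl E _≤_ ˘) ⨾ graph α))
    × Up _≤_ E (graph α ⨾ (compl E _≤_ ˘))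
lemma3p9 _≤_ E isPO isEq _ α (_ , surj) α-≤-invariant α⊆E =
  graph⨾-comm (surjective⇒strictlySurjective _≡_ refl surj)
              (invariant-˘ (invariant-compl (invariant-equivalence isEq α⊆E) α-≤-invariant))
  , Up-graph⨾compl˘ (IsPartialOrder.trans isPO) isEq
                    (λ {x} {y} → Equivalence.to (α-≤-invariant x y)) α⊆E
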